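{- There exists a closed $\lambda$-term $\mathsf{Eq}$ such that for all $n\in\mathbb N$: $\mathsf{Eq}\,\underline n\,\mathbb S_{\mathtt I}^\Omega=_{\mathcal B}\mathtt I$ and $\mathsf{Eq}\,\underline n\,\mathbb S_\eta^\Omega=_{\mathcal B}\eta_n$.
   Context: $\underline n=\lambda fz.f^n(z)$ is the $n$-th Church numeral, $\mathtt I=\lambda x.x$, $\Omega=(\lambda x.xx)(\lambda x.xx)$. Tuples $[M_1,\dots,M_n]=\lambda z.zM_1\cdots M_n$; streams $[M_n]_{n\in\mathbb N}$ are terms with $[M_n]_n=_\beta[M_0,[M_{n+1}]_n]$. $(\eta_0,\eta_1,\dots)$ is a fixed effective enumeration of closed finite $\eta$-expansions of the identity (closed $Q$ with $Q\twoheadrightarrow_{\beta\eta}\mathtt I$). $\mathbb S_{\mathtt I}^\Omega=\lambda yx.[y\Omega^{\sim n}x]_{n\in\mathbb N}$ and $\mathbb S_\eta^\Omega=\lambda yx.[y\Omega^{\sim n}(\eta_nx)]_{n\in\mathbb N}$, where $\Omega^{\sim n}$ denotes $n$ successive arguments $\Omega$. $=_{\mathcal B}$ means having the same Böhm tree. -}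

module Defs where

open import Data.Nat using (ℕ; zero; suc; _<_; _<ᵇ_; _≡ᵇ_; pred)
open import Data.Bool using (if_then_else_)
open import Data.List using (List; []; _∷_; foldl; map)
open import Data.List.Relation.Binary.Pointwise using (Pointwise)
open import Data.Product using (Σ; _×_; _,_; ∃)
open import Data.Sum using (_⊎_)
open import Data.Unit using (⊤)
open import Relation.Nullary using (¬_)
open import Relation.Binary.Construct.Closure.ReflexiveTransitive using (Star)
open import Relation.Binary.Construct.Closure.Equivalence using (EqClosure)

-- Untyped λ-terms, de Bruijn indices (var 0 = innermost binder)

data Term : Set where
  var : ℕ → Term
  lam : Term → Term
  app : Term → Term → Term

data Scoped (n : ℕ) : Term → Set where
  var : ∀ {i} → i < n → Scoped n (var i)
  lam : ∀ {t} → Scoped (suc n) t → Scoped n (lam t)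
  app : ∀ {t u} → Scoped n t → Scoped n u → Scoped n (app t u)

Closed : Term → Set
Closed = Scoped 0

lift : ℕ → Term → Term
lift c (var i)   = if i <ᵇ c then var i else var (suc i)
lift c (lam t)   = lam (lift (suc c) t)
lift c (app t u) = app (lift c t) (lift c u)

-- t [ j := s ], removing variable j (indices above j decrease)
subst : ℕ → Term → Term → Term
subst j s (var i)   = if i ≡ᵇ j then s else (if j <ᵇ i then var (pred i) else var i)
subst j s (lam t)   = lam (subst (suc j) (lift 0 s) t)
subst j s (app t u) = app (subst j s t) (subst j s u)

data _→β_ : Term → Term → Set where
  β    : ∀ {t s} → app (lam t) s →β subst 0 s t
  lamξ : ∀ {t t'} → t →β t' → lam t →β lam t'
  appL : ∀ {t t' u} → t →β t' → app t u →β app t' u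
  appR : ∀ {t u u'} → u →β u' → app t u →β app t u'

data _→βη_ : Term → Term → Set where
  β    : ∀ {t s} → app (lam t) s →βη subst 0 s t
  η    : ∀ {u} → lam (app (lift 0 u) (var 0)) →βη u
  lamξ : ∀ {t t'} → t →βη t' → lam t →βη lam t'
  appL : ∀ {t t' u} → t →βη t' → app t u →βη app t' u
  appR : ∀ {t u u'} → u →βη u' → app t u →βη app t u'

_↠β_ : Term → Term → Set
_↠β_ = Star _→β_

_↠βη_ : Term → Term → Set
_↠βη_ = Star _→βη_

_=β_ : Term → Term → Set
_=β_ = EqClosure _→β_

lams : ℕ → Term → Term
lams zero    t = t
lams (suc n) t = lam (lams n t)

apps : Term → List Term → Term
apps = foldl app

Solvable : Term → Set
Solvable M = Σ ℕ λ n → Σ ℕ λ y → Σ (List Term) λ args → M ↠β lams n (apps (var y) args)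

-- Böhm trees of M and N agree up to depth k
BTeq : ℕ → Term → Term → Set
BTeq zero    M N = ⊤
BTeq (suc k) M N =
  (¬ Solvable M × ¬ Solvable N)
  ⊎ (Σ ℕ λ n → Σ ℕ λ y → Σ (List Term) λ as → Σ (List Term) λ bs →
       M ↠β lams n (apps (var y) as) × N ↠β lams n (apps (var y) bs)
       × Pointwise (BTeq k) as bs)

-- same Böhm tree: all finite truncations coincide
_=B_ : Term → Term → Set
M =B N = ∀ k → BTeq k M N

church : ℕ → Term
church n = lam (lam (go n))
  where
  go : ℕ → Term
  go zero    = var 0
  go (suc m) = app (var 1) (go m)

I : Term
I = lam (var 0)

ω : Term
ω = lam (app (var 0) (var 0))

Ω : Term
Ω = app ω ω

-- successor on Church numerals: λ n f z. f (n f z)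
succT : Term
succT = lam (lam (lam (app (var 1) (app (app (var 2) (var 1)) (var 0)))))

-- Turing's fixed point combinator Θ = A A, A = λ x y. y (x x y)
Θ : Term
Θ = app A A
  where
  A : Term
  A = lam (lam (app (var 0) (app (app (var 1) (var 1)) (var 0))))

-- tuple [M₁,…,Mₙ] = λz. z M₁ … Mₙ
tuple : List Term → Term
tuple Ms = lam (apps (var 0) (map (lift 0) Ms))

-- stream [F n]ₙ for a term F (F applied to the numeral n gives the n-th entry):
-- [F n]ₙ = Θ (λ s m. [F m, s (succ m)]) 0, so [F n]ₙ =β [F 0, [F (n+1)]ₙ]
stream : Term → Term
stream F = app (app Θ (lam (lam
  (tuple (app (lift 0 (lift 0 F)) (var 0) ∷ app (var 1) (app succT (var 0)) ∷ [])))))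
  (church 0)

-- inside λ y x. (de Bruijn: y = var 1, x = var 0, under one more λ m: y = 2, x = 1, m = 0)
-- y Ω^{~m} = m (λ a. a Ω) y
yΩm : Term
yΩm = app (app (var 0) (lam (app (var 0) Ω))) (var 2)

-- 𝕊_I^Ω = λ y x. [ y Ω^{~n} x ]ₙ
SIΩ : Term
SIΩ = lam (lam (stream (lam (app yΩm (var 1)))))

-- 𝕊_η^Ω = λ y x. [ y Ω^{~n} (ηₙ x) ]ₙ, with E a closed term computing n ↦ ηₙ
SηΩ : Term → Term
SηΩ E = lam (lam (stream (lam (app yΩm (app (app E (var 0)) (var 1))))))

module Submission where

-- The separating term is  Eq = λ n S x. n tl (S (n K I) x) K,  where tl drops the
-- head of a stream and K selects the head.  For a stream S y x = [ y Ω^{~m} (Xₘ x) ]ₘ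
-- the term  Eq n S  β-reduces to  λx. (n K I) Ω^{~n} (Xₙ x), and  n K I = K^n I  swallows
-- the n copies of Ω; so  Eq n 𝕊_I^Ω ↠β I  and  Eq n 𝕊_η^Ω ↠β λx. E n x ↠β λx. ηₙ x.
-- Equality of Böhm trees is then obtained from a head-normal-form lemma for
-- η-expansions: if Q ↠βη λx₁…xₙ. y a₁…aₖ where every aᵢ βη-reduces to a variable, then
-- Q itself β-reduces to such a head normal form, padded by finitely many extra
-- η-abstractions (proved by postponing parallel η-steps after β-steps).  Hence terms
-- βη-reducing to a variable have a well-defined Böhm tree equal to itself, and two
-- terms β-reducing to a common head normal form with such arguments are =B.

open import Defs
open import Data.Nat using (ℕ; zero; suc; _+_; _<_; _≤_; _<ᵇ_; _≡ᵇ_; pred; z≤n; s≤s; _<?_)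
open import Data.Nat.Properties
  using (<-cmp; ≮⇒≥; ≤-reflexive; ≤-trans; <-≤-trans; n≤1+n; <⇒≤; ≤-pred; <-irrefl; +-identityʳ; +-assoc; +-suc; +-comm; +-monoʳ-≤)
open import Data.Bool using (true; false)
open import Data.List using (List; []; _∷_; _∷ʳ_; map)
open import Data.List.Relation.Unary.All as All using (All; []; _∷_)
open import Data.List.Relation.Unary.All.Properties using (∷ʳ⁺; ∷ʳ⁻; map⁺)
open import Data.List.Relation.Binary.Pointwise using (Pointwise; []; _∷_)
open import Data.Product using (Σ; _×_; _,_; proj₁; proj₂; uncurry)
open import Data.Sum using (_⊎_; inj₁; inj₂)
open import Data.Unit using (tt)
open import Data.Empty using (⊥-elim)
open import Relation.Nullary using (Dec; yes; no; ¬_)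
open import Relation.Nullary.Decidable using (map′; _×-dec_; toWitness)
open import Relation.Binary using (tri<; tri≈; tri>)
open import Relation.Binary.PropositionalEquality using (_≡_; refl; sym; trans; cong; cong₂)
open import Relation.Binary.Construct.Closure.ReflexiveTransitive using (Star; ε; _◅_; _◅◅_; gmap)

<ᵇ-true : ∀ {i c} → i < c → (i <ᵇ c) ≡ true
<ᵇ-true {zero}  {suc c} _       = refl
<ᵇ-true {suc i} {suc c} (s≤s p) = <ᵇ-true p

<ᵇ-false : ∀ {i c} → c ≤ i → (i <ᵇ c) ≡ false
<ᵇ-false {i}     {zero}  _       = refl
<ᵇ-false {suc i} {suc c} (s≤s p) = <ᵇ-false p

≡ᵇ-refl : ∀ i → (i ≡ᵇ i) ≡ true
≡ᵇ-refl zero    = refl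
≡ᵇ-refl (suc i) = ≡ᵇ-refl i

≡ᵇ-false< : ∀ {i j} → i < j → (i ≡ᵇ j) ≡ false
≡ᵇ-false< {zero}  {suc j} _       = refl
≡ᵇ-false< {suc i} {suc j} (s≤s p) = ≡ᵇ-false< p

≡ᵇ-false> : ∀ {i j} → j < i → (i ≡ᵇ j) ≡ false
≡ᵇ-false> {suc i} {zero}  _       = refl
≡ᵇ-false> {suc i} {suc j} (s≤s p) = ≡ᵇ-false> p

lift-var< : ∀ {c i} → i < c → lift c (var i) ≡ var i
lift-var< p rewrite <ᵇ-true p = refl

lift-var≥ : ∀ {c i} → c ≤ i → lift c (var i) ≡ var (suc i)
lift-var≥ p rewrite <ᵇ-false p = refl

subst-var≡ : ∀ j s → subst j s (var j) ≡ s
subst-var≡ j s rewrite ≡ᵇ-refl j = refl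

subst-var< : ∀ {j s i} → i < j → subst j s (var i) ≡ var i
subst-var< p rewrite ≡ᵇ-false< p | <ᵇ-false (<⇒≤ p) = refl

subst-var> : ∀ {j s i} → j < i → subst j s (var i) ≡ var (pred i)
subst-var> p rewrite ≡ᵇ-false> p | <ᵇ-true p = refl

lift-lift : ∀ {c c'} t → c ≤ c' → lift (suc c') (lift c t) ≡ lift c (lift c' t)
lift-lift {c} {c'} (var i) p with i <? c | i <? c'
... | yes i<c | _ =
  trans (cong (lift (suc c')) (lift-var< i<c))
    (trans (lift-var< (≤-trans i<c (≤-trans p (n≤1+n _))))
      (sym (trans (cong (lift c) (lift-var< (≤-trans i<c p))) (lift-var< i<c))))
... | no i≮c | yes i<c' =
  trans (cong (lift (suc c')) (lift-var≥ (≮⇒≥ i≮c)))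
    (trans (lift-var< (s≤s i<c'))
      (sym (trans (cong (lift c) (lift-var< i<c')) (lift-var≥ (≮⇒≥ i≮c)))))
... | no i≮c | no i≮c' =
  trans (cong (lift (suc c')) (lift-var≥ (≮⇒≥ i≮c)))
    (trans (lift-var≥ (s≤s (≮⇒≥ i≮c')))
      (sym (trans (cong (lift c) (lift-var≥ (≮⇒≥ i≮c'))) (lift-var≥ (≤-trans (≮⇒≥ i≮c) (n≤1+n _))))))
lift-lift (lam t)   p = cong lam (lift-lift t (s≤s p))
lift-lift (app t u) p = cong₂ app (lift-lift t p) (lift-lift u p)

subst-lift-cancel : ∀ j s t → subst j s (lift j t) ≡ t
subst-lift-cancel j s (var i) with i <? j
... | yes p = trans (cong (subst j s) (lift-var< p)) (subst-var< p)
... | no p  = trans (cong (subst j s) (lift-var≥ (≮⇒≥ p))) (subst-var> (s≤s (≮⇒≥ p)))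
subst-lift-cancel j s (lam t)   = cong lam (subst-lift-cancel (suc j) (lift 0 s) t)
subst-lift-cancel j s (app t u) = cong₂ app (subst-lift-cancel j s t) (subst-lift-cancel j s u)

-- lifting above j and then substituting var j for j is the identity (the β-step of an η-redex)
subst-var-lift : ∀ j t → subst j (var j) (lift (suc j) t) ≡ t
subst-var-lift j (var i) with i <? suc j
... | no p = trans (cong (subst j (var j)) (lift-var≥ (≮⇒≥ p))) (subst-var> (≤-trans (n≤1+n _) (s≤s (≮⇒≥ p))))
... | yes p with <-cmp i j
...   | tri< q _ _    = trans (cong (subst j (var j)) (lift-var< p)) (subst-var< q)
...   | tri≈ _ refl _ = trans (cong (subst j (var j)) (lift-var< p)) (subst-var≡ j (var j))
...   | tri> _ _ q    = ⊥-elim (<-irrefl refl (<-≤-trans q (≤-pred p)))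
subst-var-lift j (lam t)   = cong lam (subst-var-lift (suc j) t)
subst-var-lift j (app t u) = cong₂ app (subst-var-lift j t) (subst-var-lift j u)

subst-lift-comm : ∀ {c j} s t → c ≤ j → subst (suc j) (lift c s) (lift c t) ≡ lift c (subst j s t)
subst-lift-comm {c} {j} s (var i) p with i <? c
... | yes i<c =
  trans (cong (subst (suc j) (lift c s)) (lift-var< i<c))
    (trans (subst-var< (≤-trans i<c (≤-trans p (n≤1+n _))))
      (sym (trans (cong (lift c) (subst-var< (≤-trans i<c p))) (lift-var< i<c))))
... | no i≮c with <-cmp i j
...   | tri< q _ _ =
  trans (cong (subst (suc j) (lift c s)) (lift-var≥ (≮⇒≥ i≮c)))
    (trans (subst-var< (s≤s q)) (sym (trans (cong (lift c) (subst-var< q)) (lift-var≥ (≮⇒≥ i≮c)))))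
...   | tri≈ _ refl _ =
  trans (cong (subst (suc j) (lift c s)) (lift-var≥ (≮⇒≥ i≮c)))
    (trans (subst-var≡ (suc j) (lift c s)) (sym (cong (lift c) (subst-var≡ j s))))
subst-lift-comm {c} {j} s (var (suc i)) p | no i≮c | tri> _ _ (s≤s q) =
  trans (cong (subst (suc j) (lift c s)) (lift-var≥ (≮⇒≥ i≮c)))
    (trans (subst-var> (s≤s (s≤s q))) (sym (trans (cong (lift c) (subst-var> (s≤s q))) (lift-var≥ (≤-trans p q)))))
subst-lift-comm {c} {j} s (lam t) p =
  cong lam (trans (cong (λ z → subst (suc (suc j)) z (lift (suc c) t)) (sym (lift-lift s z≤n)))
                  (subst-lift-comm (lift 0 s) t (s≤s p)))
subst-lift-comm s (app t u) p = cong₂ app (subst-lift-comm s t p) (subst-lift-comm s u p)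

lift-subst : ∀ {c j} s t → j ≤ c → lift c (subst j s t) ≡ subst j (lift c s) (lift (suc c) t)
lift-subst {c} {j} s (var i) p with <-cmp i j
... | tri< q _ _ =
  trans (cong (lift c) (subst-var< q))
    (trans (lift-var< (≤-trans q p))
      (sym (trans (cong (subst j (lift c s)) (lift-var< (≤-trans q (≤-trans p (n≤1+n _))))) (subst-var< q))))
... | tri≈ _ refl _ =
  trans (cong (lift c) (subst-var≡ j s))
    (sym (trans (cong (subst j (lift c s)) (lift-var< (s≤s p))) (subst-var≡ j (lift c s))))
lift-subst {c} {j} s (var (suc i)) p | tri> _ _ q with i <? c
... | yes r =
  trans (cong (lift c) (subst-var> q))
    (trans (lift-var< r) (sym (trans (cong (subst j (lift c s)) (lift-var< (s≤s r))) (subst-var> q))))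
... | no r =
  trans (cong (lift c) (subst-var> q))
    (trans (lift-var≥ (≮⇒≥ r))
      (sym (trans (cong (subst j (lift c s)) (lift-var≥ (s≤s (≮⇒≥ r)))) (subst-var> (≤-trans q (n≤1+n _))))))
lift-subst {c} {j} s (lam t) p =
  cong lam (trans (lift-subst (lift 0 s) t (s≤s p))
                  (cong (λ z → subst (suc j) z (lift (suc (suc c)) t)) (lift-lift s z≤n)))
lift-subst s (app t u) p = cong₂ app (lift-subst s t p) (lift-subst s u p)

subst-subst : ∀ {i j} s u t → i ≤ j →
  subst j s (subst i u t) ≡ subst i (subst j s u) (subst (suc j) (lift i s) t)
subst-subst {i} {j} s u (var k) p with <-cmp k i
... | tri< q _ _ =
  trans (cong (subst j s) (subst-var< q))
    (trans (subst-var< (≤-trans q p))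
      (sym (trans (cong (subst i (subst j s u)) (subst-var< (≤-trans q (≤-trans p (n≤1+n _))))) (subst-var< q))))
... | tri≈ _ refl _ =
  trans (cong (subst j s) (subst-var≡ i u))
    (sym (trans (cong (subst i (subst j s u)) (subst-var< (s≤s p))) (subst-var≡ i (subst j s u))))
subst-subst {i} {j} s u (var (suc k)) p | tri> _ _ q with <-cmp k j
... | tri< r _ _ =
  trans (cong (subst j s) (subst-var> q))
    (trans (subst-var< r) (sym (trans (cong (subst i (subst j s u)) (subst-var< (s≤s r))) (subst-var> q))))
... | tri≈ _ refl _ =
  trans (cong (subst j s) (subst-var> q))
    (trans (subst-var≡ j s)
      (sym (trans (cong (subst i (subst j s u)) (subst-var≡ (suc j) (lift i s))) (subst-lift-cancel i (subst j s u) s))))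
subst-subst {i} {j} s u (var (suc (suc k))) p | tri> _ _ q | tri> _ _ (s≤s r) =
  trans (cong (subst j s) (subst-var> q))
    (trans (subst-var> (s≤s r))
      (sym (trans (cong (subst i (subst j s u)) (subst-var> (s≤s (s≤s r)))) (subst-var> (s≤s (≤-trans p r))))))
subst-subst {i} {j} s u (lam t) p =
  cong lam (trans (subst-subst (lift 0 s) (lift 0 u) t (s≤s p))
                  (cong₂ (λ a b → subst (suc i) a (subst (suc (suc j)) b t)) (subst-lift-comm s u z≤n) (lift-lift s z≤n)))
subst-subst s u (app t t') p = cong₂ app (subst-subst s u t p) (subst-subst s u t' p)

scoped-weaken : ∀ {m m' t} → Scoped m t → m ≤ m' → Scoped m' t
scoped-weaken (var p)   q = var (<-≤-trans p q)
scoped-weaken (lam s)   q = lam (scoped-weaken s (s≤s q))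
scoped-weaken (app s u) q = app (scoped-weaken s q) (scoped-weaken u q)

closed-scoped : ∀ {t} n → Closed t → Scoped n t
closed-scoped n c = scoped-weaken c z≤n

scoped-lift : ∀ {n t} c → Scoped n t → Scoped (suc n) (lift c t)
scoped-lift {n} c (var {i} p) with i <? c
... | yes q rewrite lift-var< q = var (≤-trans p (n≤1+n _))
... | no q  rewrite lift-var≥ (≮⇒≥ q) = var (s≤s p)
scoped-lift c (lam s)   = lam (scoped-lift (suc c) s)
scoped-lift c (app s u) = app (scoped-lift c s) (scoped-lift c u)

lift-scoped : ∀ {k t} c → Scoped k t → k ≤ c → lift c t ≡ t
lift-scoped c (var p)   q = lift-var< (<-≤-trans p q)
lift-scoped c (lam s)   q = cong lam (lift-scoped (suc c) s (s≤s q))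
lift-scoped c (app s u) q = cong₂ app (lift-scoped c s q) (lift-scoped c u q)

subst-scoped : ∀ {k t} j s → Scoped k t → k ≤ j → subst j s t ≡ t
subst-scoped j s (var p)   q = subst-var< (<-≤-trans p q)
subst-scoped j s (lam x)   q = cong lam (subst-scoped (suc j) (lift 0 s) x (s≤s q))
subst-scoped j s (app x u) q = cong₂ app (subst-scoped j s x q) (subst-scoped j s u q)

lift-closed : ∀ {t} c → Closed t → lift c t ≡ t
lift-closed c s = lift-scoped c s z≤n

subst-closed : ∀ {t} j s → Closed t → subst j s t ≡ t
subst-closed j s x = subst-scoped j s x z≤n

-- scoping is decidable; for concrete terms it is established by evaluation (toWitness)
scoped? : ∀ n t → Dec (Scoped n t)
scoped? n (var i)   = map′ var (λ { (var p) → p }) (i <? n)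
scoped? n (lam t)   = map′ lam (λ { (lam s) → s }) (scoped? (suc n) t)
scoped? n (app t u) = map′ (uncurry app) (λ { (app s v) → s , v }) (scoped? n t ×-dec scoped? n u)

β≡ : ∀ {t s u} → subst 0 s t ≡ u → app (lam t) s →β u
β≡ refl = β

βη-β≡ : ∀ {t s u} → subst 0 s t ≡ u → app (lam t) s →βη u
βη-β≡ refl = β

βη-η≡ : ∀ {u v} → v ≡ lift 0 u → lam (app v (var 0)) →βη u
βη-η≡ refl = η

_↠≡_ : ∀ {R : Term → Term → Set} {a b c} → Star R a b → b ≡ c → Star R a c
r ↠≡ refl = r

lam↠ : ∀ {t t'} → t ↠β t' → lam t ↠β lam t'
lam↠ = gmap lam lamξ

appL↠ : ∀ {t t' u} → t ↠β t' → app t u ↠β app t' u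
appL↠ {u = u} = gmap (λ z → app z u) appL

appR↠ : ∀ {t u u'} → u ↠β u' → app t u ↠β app t u'
appR↠ {t = t} = gmap (app t) appR

lamη↠ : ∀ {t t'} → t ↠βη t' → lam t ↠βη lam t'
lamη↠ = gmap lam lamξ

appLη↠ : ∀ {t t' u} → t ↠βη t' → app t u ↠βη app t' u
appLη↠ {u = u} = gmap (λ z → app z u) appL

appRη↠ : ∀ {t u u'} → u ↠βη u' → app t u ↠βη app t u'
appRη↠ {t = t} = gmap (app t) appR

lift-β : ∀ c {t t'} → t →β t' → lift c t →β lift c t'
lift-β c (β {t} {s}) = β≡ (sym (lift-subst s t z≤n))
lift-β c (lamξ r)    = lamξ (lift-β (suc c) r)
lift-β c (appL r)    = appL (lift-β c r)
lift-β c (appR r)    = appR (lift-β c r)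

lift-βη : ∀ c {t t'} → t →βη t' → lift c t →βη lift c t'
lift-βη c (β {t} {s}) = βη-β≡ (sym (lift-subst s t z≤n))
lift-βη c (η {u})     = βη-η≡ (lift-lift u z≤n)
lift-βη c (lamξ r)    = lamξ (lift-βη (suc c) r)
lift-βη c (appL r)    = appL (lift-βη c r)
lift-βη c (appR r)    = appR (lift-βη c r)

subst-βη : ∀ j s {t t'} → t →βη t' → subst j s t →βη subst j s t'
subst-βη j s (β {t} {u}) = βη-β≡ (sym (subst-subst s u t z≤n))
subst-βη j s (η {u})     = βη-η≡ (subst-lift-comm s u z≤n)
subst-βη j s (lamξ r)    = lamξ (subst-βη (suc j) (lift 0 s) r)
subst-βη j s (appL r)    = appL (subst-βη j s r)
subst-βη j s (appR r)    = appR (subst-βη j s r)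

lift-↠β : ∀ c {t t'} → t ↠β t' → lift c t ↠β lift c t'
lift-↠β c = gmap (lift c) (lift-β c)

lift-↠βη : ∀ c {t t'} → t ↠βη t' → lift c t ↠βη lift c t'
lift-↠βη c = gmap (lift c) (lift-βη c)

subst-↠βη : ∀ j s {t t'} → t ↠βη t' → subst j s t ↠βη subst j s t'
subst-↠βη j s = gmap (subst j s) (subst-βη j s)

hnf : ℕ → ℕ → List Term → Term
hnf n y as = lams n (apps (var y) as)

apps-snoc : ∀ h as a → apps h (as ∷ʳ a) ≡ app (apps h as) a
apps-snoc h []       a = refl
apps-snoc h (b ∷ as) a = apps-snoc (app h b) as a

lift-apps : ∀ c h as → lift c (apps h as) ≡ apps (lift c h) (map (lift c) as)
lift-apps c h []       = refl
lift-apps c h (a ∷ as) = lift-apps c (app h a) as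

subst-apps : ∀ j s h as → subst j s (apps h as) ≡ apps (subst j s h) (map (subst j s) as)
subst-apps j s h []       = refl
subst-apps j s h (a ∷ as) = subst-apps j s (app h a) as

apps-app : ∀ p q as → Σ Term λ p' → Σ Term λ q' → apps (app p q) as ≡ app p' q'
apps-app p q []       = p , q , refl
apps-app p q (a ∷ as) = apps-app (app p q) a as

lam≢apps : ∀ {t} y as → ¬ (lam t ≡ apps (var y) as)
lam≢apps y []       ()
lam≢apps y (a ∷ as) e with apps-app (var y) a as
... | _ , _ , e' with trans e e'
... | ()

var≡apps : ∀ {i} y as → var i ≡ apps (var y) as → (as ≡ []) × (i ≡ y)
var≡apps y []       refl = refl , refl
var≡apps y (a ∷ as) e with apps-app (var y) a as
... | _ , _ , e' with trans e e'
... | ()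

app≡apps : ∀ h as p q → app p q ≡ apps h as →
  ((as ≡ []) × (app p q ≡ h)) ⊎ (Σ (List Term) λ init → (as ≡ init ∷ʳ q) × (p ≡ apps h init))
app≡apps h []       p q e = inj₁ (refl , e)
app≡apps h (a ∷ as) p q e with app≡apps (app h a) as p q e
... | inj₁ (refl , refl)          = inj₂ ([] , refl , refl)
... | inj₂ (init , refl , refl)   = inj₂ (a ∷ init , refl , refl)

liftN : ℕ → Term → Term
liftN zero    s = s
liftN (suc k) s = lift 0 (liftN k s)

liftN-lift : ∀ k s → liftN k (lift 0 s) ≡ lift 0 (liftN k s)
liftN-lift zero    s = refl
liftN-lift (suc k) s = cong (lift 0) (liftN-lift k s)

subst-lams : ∀ j s k t → subst j s (lams k t) ≡ lams k (subst (k + j) (liftN k s) t)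
subst-lams j s zero    t = refl
subst-lams j s (suc k) t =
  cong lam (trans (subst-lams (suc j) (lift 0 s) k t)
                  (cong₂ (λ a b → lams k (subst a b t)) (+-suc k j) (liftN-lift k s)))

-- β-contracting a head normal form  λx₀ x₁…xₖ. x_{z+1} a⃗  (z ≥ k, so the head is not x₀)
β-hnf : ∀ k z s as → k ≤ z →
  subst 0 s (hnf k (suc z) as) ≡ hnf k z (map (subst (k + 0) (liftN k s)) as)
β-hnf k z s as k≤z =
  trans (subst-lams 0 s k _)
    (cong (lams k) (trans (subst-apps (k + 0) (liftN k s) (var (suc z)) as)
      (cong (λ h → apps h (map (subst (k + 0) (liftN k s)) as)) (subst-var> {s = liftN k s} (s≤s (≤-trans (≤-reflexive (+-identityʳ k)) k≤z))))))

-- a term that βη-reduces to a variable (a finite η-expansion of it, up to β)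
EtaVar : Term → Set
EtaVar a = Σ ℕ λ w → a ↠βη var w

etaVar-lift : ∀ c {a} → EtaVar a → EtaVar (lift c a)
etaVar-lift c (w , r) with w <? c
... | yes p = w     , lift-↠βη c r ↠≡ lift-var< p
... | no p  = suc w , lift-↠βη c r ↠≡ lift-var≥ (≮⇒≥ p)

etaVar-liftN : ∀ k {a} → EtaVar a → EtaVar (liftN k a)
etaVar-liftN zero    g = g
etaVar-liftN (suc k) g = etaVar-lift 0 (etaVar-liftN k g)

etaVar-subst : ∀ j {s a} → EtaVar s → EtaVar a → EtaVar (subst j s a)
etaVar-subst j {s} (ws , rs) (w , r) with <-cmp w j
... | tri< q _ _    = w      , subst-↠βη j s r ↠≡ subst-var< q
... | tri≈ _ refl _ = ws     , (subst-↠βη j s r ↠≡ subst-var≡ j s) ◅◅ rs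
... | tri> _ _ q    = pred w , subst-↠βη j s r ↠≡ subst-var> q

-- contract any set of (possibly nested) η-redexes at once
infix 4 _⇛_
data _⇛_ : Term → Term → Set where
  var : ∀ {i} → var i ⇛ var i
  lam : ∀ {t t'} → t ⇛ t' → lam t ⇛ lam t'
  app : ∀ {a a' b b'} → a ⇛ a' → b ⇛ b' → app a b ⇛ app a' b'
  η   : ∀ {m m'} → m ⇛ m' → lam (app (lift 0 m) (var 0)) ⇛ m'

⇛-refl : ∀ t → t ⇛ t
⇛-refl (var i)   = var
⇛-refl (lam t)   = lam (⇛-refl t)
⇛-refl (app t u) = app (⇛-refl t) (⇛-refl u)

⇛-η≡ : ∀ {m m' v} → v ≡ lift 0 m → m ⇛ m' → lam (app v (var 0)) ⇛ m'
⇛-η≡ refl d = η d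

⇛-lift : ∀ c {t t'} → t ⇛ t' → lift c t ⇛ lift c t'
⇛-lift c (var {i})      = ⇛-refl (lift c (var i))
⇛-lift c (lam d)        = lam (⇛-lift (suc c) d)
⇛-lift c (app d e)      = app (⇛-lift c d) (⇛-lift c e)
⇛-lift c (η {m} d)      = ⇛-η≡ (lift-lift m z≤n) (⇛-lift c d)

⇛-subst : ∀ j {s s' t t'} → s ⇛ s' → t ⇛ t' → subst j s t ⇛ subst j s' t'
⇛-subst j {s} {s'} ds (var {i}) with <-cmp i j
... | tri< q _ _ rewrite subst-var< {j} {s} q | subst-var< {j} {s'} q = var
... | tri≈ _ refl _ rewrite subst-var≡ j s | subst-var≡ j s' = ds
... | tri> _ _ q rewrite subst-var> {j} {s} q | subst-var> {j} {s'} q = var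
⇛-subst j ds (lam d)        = lam (⇛-subst (suc j) (⇛-lift 0 ds) d)
⇛-subst j ds (app d e)      = app (⇛-subst j ds d) (⇛-subst j ds e)
⇛-subst j {s} ds (η {m} d)  = ⇛-η≡ (subst-lift-comm s m z≤n) (⇛-subst j ds d)

⇛⇒↠βη : ∀ {t t'} → t ⇛ t' → t ↠βη t'
⇛⇒↠βη var       = ε
⇛⇒↠βη (lam d)   = lamη↠ (⇛⇒↠βη d)
⇛⇒↠βη (app d e) = appLη↠ (⇛⇒↠βη d) ◅◅ appRη↠ (⇛⇒↠βη e)
⇛⇒↠βη (η d)     = lamη↠ (appLη↠ (lift-↠βη 0 (⇛⇒↠βη d))) ◅◅ (η ◅ ε)

βη-split : ∀ {t t'} → t →βη t' → (t →β t') ⊎ (t ⇛ t')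
βη-split β = inj₁ β
βη-split (η {u}) = inj₂ (η (⇛-refl u))
βη-split (lamξ r) with βη-split r
... | inj₁ b = inj₁ (lamξ b)
... | inj₂ d = inj₂ (lam d)
βη-split (appL {u = u} r) with βη-split r
... | inj₁ b = inj₁ (appL b)
... | inj₂ d = inj₂ (app d (⇛-refl u))
βη-split (appR {t = t} r) with βη-split r
... | inj₁ b = inj₁ (appR b)
... | inj₂ d = inj₂ (app (⇛-refl t) d)

⇛-postpone-redex : ∀ {a t' s s'} → a ⇛ lam t' → s ⇛ s' →
  Σ Term λ Q → app a s ↠β Q × Q ⇛ subst 0 s' t'
⇛-postpone-redex {s = s} (lam {t} dt) ds = subst 0 s t , β ◅ ε , ⇛-subst 0 ds dt
⇛-postpone-redex {s = s} (η {m} dm) ds with ⇛-postpone-redex dm ds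
... | Q , r , dq = Q , β≡ (cong (λ z → app z s) (subst-lift-cancel 0 s m)) ◅ r , dq

⇛-postpone : ∀ {M N P} → M ⇛ N → N →β P → Σ Term λ Q → M ↠β Q × Q ⇛ P
⇛-postpone var ()
⇛-postpone (lam d) (lamξ r) with ⇛-postpone d r
... | Q , r' , dq = lam Q , lam↠ r' , lam dq
⇛-postpone (app d e) β = ⇛-postpone-redex d e
⇛-postpone (app {b = b} d e) (appL r) with ⇛-postpone d r
... | Q , r' , dq = app Q b , appL↠ r' , app dq e
⇛-postpone (app {a = a} d e) (appR r) with ⇛-postpone e r
... | Q , r' , dq = app a Q , appR↠ r' , app d dq
⇛-postpone (η d) r with ⇛-postpone d r
... | Q , r' , dq = lam (app (lift 0 Q) (var 0)) , lam↠ (appL↠ (lift-↠β 0 r')) , η dq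

⇛-postpone* : ∀ {M N P} → M ⇛ N → N ↠β P → Σ Term λ Q → M ↠β Q × Q ⇛ P
⇛-postpone* d ε = _ , ε , d
⇛-postpone* d (r ◅ rs) with ⇛-postpone d r
... | Q , r' , dq with ⇛-postpone* dq rs
...   | Q' , r'' , dq' = Q' , r' ◅◅ r'' , dq'

-- X β-reduces to the head normal form  λx₁…xₙ. y a⃗  padded by d further
-- η-abstractions, i.e. to  λ^{d+n}. (d+y) a⃗', with η-expanded variables as arguments
PaddedHead : ℕ → ℕ → Term → Set
PaddedHead n y X =
  Σ ℕ λ d → Σ (List Term) λ as → X ↠β hnf (d + n) (d + y) as × All EtaVar as

padded-pre : ∀ {n y X Y} → X ↠β Y → PaddedHead n y Y → PaddedHead n y X
padded-pre r (d , as , r' , g) = d , as , r ◅◅ r' , g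

padded-shift : ∀ {n y X} d → PaddedHead (d + n) (d + y) X → PaddedHead n y X
padded-shift {n} {y} d (e , as , r , g) =
  e + d , as , r ↠≡ cong₂ (λ a b → hnf a b as) (sym (+-assoc e d n)) (sym (+-assoc e d y)) , g

padded-lam : ∀ {n y X} → PaddedHead n y X → PaddedHead (suc n) y (lam X)
padded-lam {n} {y} (d , as , r , g) =
  d , as , lam↠ r ↠≡ cong (λ k → hnf k (d + y) as) (sym (+-suc d n)) , g

-- applying a padded head without leading abstractions to an η-expanded variable:
-- either the argument is appended, or it is consumed by a padding abstraction
padded-app : ∀ {y a b} → PaddedHead 0 y a → EtaVar b → PaddedHead 0 y (app a b)
padded-app {y} {b = b} (zero , as , r , g) gb =
  0 , as ∷ʳ b , appL↠ r ↠≡ sym (apps-snoc (var y) as b) , ∷ʳ⁺ g gb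
padded-app {y} {b = b} (suc d , as , r , g) gb =
  d , map (subst (d + 0 + 0) (liftN (d + 0) b)) as ,
  (appL↠ r ◅◅ (β ◅ ε)) ↠≡ β-hnf (d + 0) (d + y) b as (+-monoʳ-≤ d z≤n) ,
  map⁺ (All.map (etaVar-subst (d + 0 + 0) (etaVar-liftN (d + 0) gb)) g)

η-expansion-of-lam : ∀ {m t} → m ↠β lam t → lam (app (lift 0 m) (var 0)) ↠β lam t
η-expansion-of-lam {t = t} r =
  lam↠ (appL↠ (lift-↠β 0 r)) ◅◅ (lamξ (β≡ (subst-var-lift 0 t)) ◅ ε)

padded-η : ∀ {n y m} → PaddedHead n y m → PaddedHead n y (lam (app (lift 0 m) (var 0)))
padded-η (d , as , r , g) = padded-shift d (η-expand (d + _) r g)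
  where
  η-expand : ∀ {m y as} k → m ↠β hnf k y as → All EtaVar as →
             PaddedHead k y (lam (app (lift 0 m) (var 0)))
  η-expand (suc k) r g = 0 , _ , η-expansion-of-lam r , g
  η-expand {y = y} {as} zero r g =
    1 , map (lift 0) as ∷ʳ var 0 ,
    lam↠ (appL↠ (lift-↠β 0 r))
      ↠≡ cong lam (trans (cong (λ z → app z (var 0)) (lift-apps 0 (var y) as))
                         (sym (apps-snoc (var (suc y)) (map (lift 0) as) (var 0)))) ,
    ∷ʳ⁺ (map⁺ (All.map (etaVar-lift 0) g)) (0 , ε)

padded-⇛ : ∀ {Z T} → Z ⇛ T → ∀ n y as → T ≡ hnf n y as → All EtaVar as → PaddedHead n y Z
padded-⇛ var (suc n) y as () g
padded-⇛ var zero y as e g with var≡apps y as e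
... | refl , refl = 0 , [] , ε , []
padded-⇛ (lam d) zero    y as e    g = ⊥-elim (lam≢apps y as e)
padded-⇛ (lam d) (suc n) y as refl g = padded-lam (padded-⇛ d n y as refl g)
padded-⇛ (app d e) (suc n) y as () g
padded-⇛ (app d e) zero y as eq g with app≡apps (var y) as _ _ eq
... | inj₁ (_ , ())
... | inj₂ (init , refl , refl) with ∷ʳ⁻ g
...   | g-init , (w , r) = padded-app (padded-⇛ d zero y init refl g-init) (w , ⇛⇒↠βη e ◅◅ r)
padded-⇛ (η d) n y as e g = padded-η (padded-⇛ d n y as e g)

-- Induction on the βη-sequence,
-- postponing each η-step past the β-steps that follow it.
paddedHead : ∀ {X n y as} → X ↠βη hnf n y as → All EtaVar as → PaddedHead n y X
paddedHead ε g = 0 , _ , ε , g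
paddedHead {n = n} {y} (r ◅ rs) g with paddedHead rs g | βη-split r
... | p | inj₁ b = padded-pre (b ◅ ε) p
... | (d , as , r' , g') | inj₂ dp with ⇛-postpone* dp r'
...   | Q , rq , dq = padded-pre rq (padded-shift d (padded-⇛ dq (d + n) (d + y) as refl g'))

mutual
  BTeq-sharedHnf : ∀ k {M N n y as} → M ↠β hnf n y as → N ↠β hnf n y as → All EtaVar as → BTeq k M N
  BTeq-sharedHnf zero    _ _ _ = tt
  BTeq-sharedHnf (suc k) {n = n} {y} {as} r s g = inj₂ (n , y , as , as , r , s , BTeq-args k g)

  BTeq-etaVar : ∀ k {a} → EtaVar a → BTeq k a a
  BTeq-etaVar k (w , r) with paddedHead r []
  ... | d , as , r' , g = BTeq-sharedHnf k r' r' g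

  BTeq-args : ∀ k {as} → All EtaVar as → Pointwise (BTeq k) as as
  BTeq-args k []       = []
  BTeq-args k (g ∷ gs) = BTeq-etaVar k g ∷ BTeq-args k gs

=B-sharedHnf : ∀ {M N n y as} → M ↠β hnf n y as → N ↠β hnf n y as → All EtaVar as → M =B N
=B-sharedHnf r s g k = BTeq-sharedHnf k r s g

iter : ℕ → (Term → Term) → Term → Term
iter zero    f x = x
iter (suc n) f x = f (iter n f x)

numeralBody : ℕ → Term
numeralBody n = iter n (app (var 1)) (var 0)

-- church n is λ f z. f^n z (its body in Defs is local, so it is recovered by stripping binders)
church-body : ∀ n → church n ≡ lam (lam (numeralBody n))
church-body n = cong (λ b → lam (lam b)) (strip-church n)
  where
  strip : Term → Term
  strip (lam (lam t)) = t
  strip t             = t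
  strip-church : ∀ n → strip (church n) ≡ numeralBody n
  strip-church zero    = refl
  strip-church (suc n) = cong (app (var 1)) (strip-church n)

church-closed : ∀ n → Closed (church n)
church-closed n rewrite church-body n = lam (lam (body-scoped n))
  where
  body-scoped : ∀ n → Scoped 2 (numeralBody n)
  body-scoped zero    = var (s≤s z≤n)
  body-scoped (suc n) = app (var (s≤s (s≤s z≤n))) (body-scoped n)

church-iter : ∀ n f z → app (app (church n) f) z ↠β iter n (app f) z
church-iter n f z rewrite church-body n = appL β ◅ β≡ (instantiate n) ◅ ε
  where
  instantiate : ∀ n → subst 0 z (subst 1 (lift 0 f) (numeralBody n)) ≡ iter n (app f) z
  instantiate zero    = refl
  instantiate (suc n) = cong₂ app (subst-lift-cancel 0 z f) (instantiate n)

succ-step : ∀ m f z → app (app (app succT m) f) z ↠β app f (app (app m f) z)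
succ-step m f z = appL (appL β) ◅ appL β ◅ β≡ contractum ◅ ε
  where
  contractum : subst 0 z (app (lift 0 f) (app (app (subst 1 (lift 0 f) (lift 0 (lift 0 m))) (lift 0 f)) (var 0)))
             ≡ app f (app (app m f) z)
  contractum = cong₂ (λ a b → app a (app (app b a) z)) (subst-lift-cancel 0 z f)
    (trans (cong (subst 0 z) (trans (subst-lift-comm f (lift 0 m) z≤n) (cong (lift 0) (subst-lift-cancel 0 f m))))
           (subst-lift-cancel 0 z m))

-- the numeral  succ^k 0  (the stream index after k tail steps)
succIter : ℕ → Term
succIter k = iter k (app succT) (church 0)

succIter-iter : ∀ k f z → app (app (succIter k) f) z ↠β iter k (app f) z
succIter-iter zero    f z = appL β ◅ β ◅ ε
succIter-iter (suc k) f z = succ-step (succIter k) f z ◅◅ appR↠ (succIter-iter k f z)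

succIter-church : ∀ k → succIter k ↠β church k
succIter-church zero    = ε
succIter-church (suc k) =
  appR↠ (succIter-church k) ◅◅ (β≡ (cong (λ c → lam (lam (app (var 1) (app (app c (var 1)) (var 0))))) church-lifted) ◅ ε)
    ◅◅ (lam↠ (lam↠ (appR↠ (church-iter k (var 1) (var 0)))) ↠≡ sym (church-body (suc k)))
  where
  church-lifted : lift 0 (lift 0 (church k)) ≡ church k
  church-lifted = trans (cong (lift 0) (lift-closed 0 (church-closed k))) (lift-closed 0 (church-closed k))

K : Term
K = lam (lam (var 1))

K* : Term
K* = lam (lam (var 0))

tl : Term
tl = lam (app (var 0) K*)

fst-pair : ∀ a b → app (tuple (a ∷ b ∷ [])) K ↠β a
fst-pair a b =
  β≡ (cong₂ (λ x y → app (app K x) y) (subst-lift-cancel 0 K a) (subst-lift-cancel 0 K b)) ◅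
  appL β ◅ β≡ (subst-lift-cancel 0 b a) ◅ ε

snd-pair : ∀ a b → app (tuple (a ∷ b ∷ [])) K* ↠β b
snd-pair a b =
  β≡ (cong₂ (λ x y → app (app K* x) y) (subst-lift-cancel 0 K* a) (subst-lift-cancel 0 K* b)) ◅
  appL β ◅ β ◅ ε

-- stream F = streamFrom F 0, where streamFrom F m = [F m, streamFrom F (succ m)]
streamGen : Term → Term
streamGen F = lam (lam (tuple (app (lift 0 (lift 0 F)) (var 0) ∷ app (var 1) (app succT (var 0)) ∷ [])))

streamFrom : Term → Term → Term
streamFrom F m = app (app Θ (streamGen F)) m

unfold-stream : ∀ F m → streamFrom F m ↠β tuple (app F m ∷ streamFrom F (app succT m) ∷ [])
unfold-stream F m = appL (appL β) ◅ appL β ◅ appL β ◅ β≡ (cong₂ pair entry rest) ◅ ε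
  where
  W : Term
  W = app Θ (streamGen F)
  pair : Term → Term → Term
  pair XF XG = lam (app (app (var 0) (app XF (lift 0 m))) (app XG (app succT (lift 0 m))))
  entry : subst 1 (lift 0 m) (subst 2 (lift 0 (lift 0 W)) (lift 0 (lift 0 (lift 0 F)))) ≡ lift 0 F
  entry =
    trans (cong (subst 1 (lift 0 m))
            (trans (subst-lift-comm (lift 0 W) (lift 0 (lift 0 F)) z≤n)
                   (cong (lift 0) (trans (subst-lift-comm W (lift 0 F) z≤n) (cong (lift 0) (subst-lift-cancel 0 W F))))))
          (trans (subst-lift-comm m (lift 0 F) z≤n) (cong (lift 0) (subst-lift-cancel 0 m F)))
  rest : subst 1 (lift 0 m) (lift 0 (lift 0 W)) ≡ lift 0 W
  rest = trans (subst-lift-comm m (lift 0 W) z≤n) (cong (lift 0) (subst-lift-cancel 0 m W))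

stream-head : ∀ F m → app (streamFrom F m) K ↠β app F m
stream-head F m = appL↠ (unfold-stream F m) ◅◅ fst-pair (app F m) (streamFrom F (app succT m))

stream-tail : ∀ F m → app tl (streamFrom F m) ↠β streamFrom F (app succT m)
stream-tail F m = β ◅ appL↠ (unfold-stream F m) ◅◅ snd-pair (app F m) (streamFrom F (app succT m))

stream-drop : ∀ k F m → iter k (app tl) (streamFrom F m) ↠β streamFrom F (iter k (app succT) m)
stream-drop zero    F m = ε
stream-drop (suc k) F m = appR↠ (stream-drop k F m) ◅◅ stream-tail F (iter k (app succT) m)

subst-stream : ∀ j s F → subst j s (stream F) ≡ stream (subst j s F)
subst-stream j s F =
  cong skeleton (trans (subst-lift-comm (lift 0 (lift 0 s)) (lift 0 (lift 0 F)) z≤n)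
    (cong (lift 0) (trans (subst-lift-comm (lift 0 s) (lift 0 F) z≤n) (cong (lift 0) (subst-lift-comm s F z≤n)))))
  where
  skeleton : Term → Term
  skeleton X = app (app Θ (lam (lam (lam (app (app (var 0) (app X (var 1))) (app (var 2) (app succT (var 1))))))))
                   (church 0)

stream-scoped : ∀ {n F} → Scoped n F → Scoped n (stream F)
stream-scoped {n} sF =
  app (app (closed-scoped n (toWitness {a? = scoped? 0 Θ} tt))
       (lam (lam (lam (app (app (var (s≤s z≤n)) (app (scoped-lift 0 (scoped-lift 0 (scoped-lift 0 sF))) (var (s≤s (s≤s z≤n)))))
                           (app (var (s≤s (s≤s (s≤s z≤n))))
                                (app (closed-scoped (suc (suc (suc n))) (toWitness {a? = scoped? 0 succT} tt))
                                     (var (s≤s (s≤s z≤n))))))))))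
      (closed-scoped n (church-closed 0))

withArgs : Term → Term → ℕ → Term
withArgs D A k = iter k (λ t → app t A) D

withArgs-cong : ∀ {D D'} A k → D ↠β D' → withArgs D A k ↠β withArgs D' A k
withArgs-cong A zero    r = r
withArgs-cong A (suc k) r = appL↠ (withArgs-cong A k r)

withArgs-suc : ∀ D A k → withArgs D A (suc k) ≡ withArgs (app D A) A k
withArgs-suc D A zero    = refl
withArgs-suc D A (suc k) = cong (λ t → app t A) (withArgs-suc D A k)

K-swallow : ∀ A k X → withArgs (iter k (app K) X) A k ↠β X
K-swallow A zero    X = ε
K-swallow A (suc k) X =
  (ε ↠≡ withArgs-suc (app K (iter k (app K) X)) A k)
  ◅◅ withArgs-cong A k (appL β ◅ β≡ (subst-lift-cancel 0 A (iter k (app K) X)) ◅ ε)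
  ◅◅ K-swallow A k X

fΩ : Term
fΩ = lam (app (var 0) Ω)

fΩ-iter : ∀ k D → iter k (app fΩ) D ↠β withArgs D Ω k
fΩ-iter zero    D = ε
fΩ-iter (suc k) D = appR↠ (fΩ-iter k D) ◅◅ (β ◅ ε)

discard : ℕ → Term
discard n = app (app (church n) K) I

discard-closed : ∀ n → Closed (discard n)
discard-closed n =
  app (app (church-closed n) (toWitness {a? = scoped? 0 K} tt)) (toWitness {a? = scoped? 0 I} tt)

-- (n K I) Ω^{~n} Y ↠β Y, with the Ω's supplied by the stream index succ^n 0
discard-Ω : ∀ n Y → app (app (app (succIter n) fΩ) (discard n)) Y ↠β Y
discard-Ω n Y =
  appL↠ (succIter-iter n fΩ (discard n) ◅◅ fΩ-iter n (discard n)
         ◅◅ withArgs-cong Ω n (church-iter n K I) ◅◅ K-swallow Ω n I)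
  ◅◅ (β ◅ ε)

-- Eq = λ n S x. n tl (S (n K I) x) K
EqTerm : Term
EqTerm = lam (lam (lam (app (app (app (var 2) tl) (app (app (var 1) (app (app (var 2) K) I)) (var 0))) K)))

EqTerm-closed : Closed EqTerm
EqTerm-closed = toWitness {a? = scoped? 0 EqTerm} tt

Eq-unfold : ∀ n S → Closed S →
  app (app EqTerm (church n)) S ↠β lam (app (app (app (church n) tl) (app (app S (discard n)) (var 0))) K)
Eq-unfold n S closed-S = appL β ◅ β≡ (cong₂ body numeral (lift-closed 0 closed-S)) ◅ ε
  where
  body : Term → Term → Term
  body c S' = lam (app (app (app c tl) (app (app S' (app (app c K) I)) (var 0))) K)
  numeral : subst 1 (lift 0 S) (lift 0 (lift 0 (church n))) ≡ church n
  numeral = trans (cong (subst 1 (lift 0 S)) (trans (cong (lift 0) (lift-closed 0 (church-closed n)))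
                                                    (lift-closed 0 (church-closed n))))
                  (subst-closed 1 (lift 0 S) (church-closed n))

-- the streams  λ y x. [ y Ω^{~m} X ]ₘ,  X a term in y, x and the index m
-- (de Bruijn: y = 2, x = 1, m = 0);  𝕊_I^Ω and 𝕊_η^Ω are of this form
ΩStream : Term → Term
ΩStream X = lam (lam (stream (lam (app yΩm X))))

ΩStream-closed : ∀ {X} → Scoped 3 X → Closed (ΩStream X)
ΩStream-closed sX = lam (lam (stream-scoped (lam (app (toWitness {a? = scoped? 3 yΩm} tt) sX))))

-- the n-th entry X with y := n K I, m := succ^n 0 and x the outer variable
ΩStream-entry : ℕ → Term → Term
ΩStream-entry n X = subst 0 (succIter n) (subst 1 (var 1) (subst 2 (lift 0 (lift 0 (discard n))) X))

Eq-ΩStream : ∀ n X → Scoped 3 X → app (app EqTerm (church n)) (ΩStream X) ↠β lam (ΩStream-entry n X)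
Eq-ΩStream n X sX =
  Eq-unfold n (ΩStream X) (ΩStream-closed sX)
  ◅◅ lam↠ (appL↠ (appR↠ instantiate-stream ◅◅ church-iter n tl _ ◅◅ stream-drop n F (church 0))
           ◅◅ stream-head F (succIter n)
           ◅◅ (β≡ (cong (λ d → app (app (app (succIter n) fΩ) d) (ΩStream-entry n X)) discard-instantiated) ◅ ε)
           ◅◅ discard-Ω n (ΩStream-entry n X))
  where
  D : Term
  D = discard n
  F₀ : Term
  F₀ = lam (app yΩm X)
  F : Term
  F = subst 0 (var 0) (subst 1 (lift 0 D) F₀)
  instantiate-stream : app (app (ΩStream X) D) (var 0) ↠β stream F
  instantiate-stream =
    appL (β≡ (cong lam (subst-stream 1 (lift 0 D) F₀))) ◅ β≡ (subst-stream 0 (var 0) (subst 1 (lift 0 D) F₀)) ◅ ε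
  discard-instantiated : subst 0 (succIter n) (subst 1 (var 1) (lift 0 (lift 0 D))) ≡ D
  discard-instantiated =
    trans (cong (subst 0 (succIter n))
            (trans (cong (subst 1 (var 1)) (trans (cong (lift 0) (lift-closed 0 (discard-closed n)))
                                                  (lift-closed 0 (discard-closed n))))
                   (subst-closed 1 (var 1) (discard-closed n))))
          (subst-closed 0 (succIter n) (discard-closed n))

Eq-SIΩ : ∀ n → app (app EqTerm (church n)) SIΩ ↠β I
Eq-SIΩ n = Eq-ΩStream n (var 1) (var (s≤s (s≤s z≤n)))

Eq-SηΩ : ∀ n E → Closed E → app (app EqTerm (church n)) (SηΩ E) ↠β lam (app (app E (church n)) (var 0))
Eq-SηΩ n E closed-E =
  (Eq-ΩStream n X sX ↠≡ cong (λ e → lam (app (app e (succIter n)) (var 0))) E-instantiated)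
  ◅◅ lam↠ (appL↠ (appR↠ (succIter-church n)))
  where
  X : Term
  X = app (app E (var 0)) (var 1)
  sX : Scoped 3 X
  sX = app (app (closed-scoped 3 closed-E) (var (s≤s z≤n))) (var (s≤s (s≤s z≤n)))
  E-instantiated : subst 0 (succIter n) (subst 1 (var 1) (subst 2 (lift 0 (lift 0 (discard n))) E)) ≡ E
  E-instantiated =
    trans (cong (subst 0 (succIter n)) (trans (cong (subst 1 (var 1)) (subst-closed 2 _ closed-E))
                                              (subst-closed 1 _ closed-E)))
          (subst-closed 0 _ closed-E)

lemma6p4 : (η : ℕ → Term) (E : Term) → Closed E
    → (∀ n → app E (church n) ↠β η n)
    → (∀ n → Closed (η n) × η n ↠βη I)
    → (∀ Q → Closed Q → Q ↠βη I → Σ ℕ λ n → η n ≡ Q)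
    → Σ Term λ Eq → Closed Eq × (∀ n →
        (app (app Eq (church n)) SIΩ =B I) × (app (app Eq (church n)) (SηΩ E) =B η n))
lemma6p4 ηₛ E closed-E E-computes ηₛ-expand-I _ =
  EqTerm , EqTerm-closed , λ n → on-SIΩ n , on-SηΩ n
  where
  on-SIΩ : ∀ n → app (app EqTerm (church n)) SIΩ =B I
  on-SIΩ n = =B-sharedHnf (Eq-SIΩ n) ε []

  -- ηₙ ↠βη I, so ηₙ ↠β λx₀…x_d. x_d a⃗ by the head lemma, and so does  λx. ηₙ x
  on-SηΩ : ∀ n → app (app EqTerm (church n)) (SηΩ E) =B ηₛ n
  on-SηΩ n with paddedHead {n = 1} {y = 0} {as = []} (proj₂ (ηₛ-expand-I n)) []
  ... | d , as , r , g =
    =B-sharedHnf (Eq-SηΩ n E closed-E ◅◅ lam↠ (appL↠ (E-computes n ↠≡ sym ηₙ-lifted))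
                  ◅◅ η-expansion-of-lam ηₙ-hnf)
                 ηₙ-hnf g
    where
    ηₙ-lifted : lift 0 (ηₛ n) ≡ ηₛ n
    ηₙ-lifted = lift-closed 0 (proj₁ (ηₛ-expand-I n))
    ηₙ-hnf : ηₛ n ↠β hnf (suc d) (d + 0) as
    ηₙ-hnf = r ↠≡ cong (λ k → hnf k (d + 0) as) (+-comm d 1)
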